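{- Let $X$ be a finite set, let $f:2^X\to\mathbb{N}$ be a symmetric submodular function, and let $k$ be a natural number such that $f(\{e\})\le k$ for every $e\in X$. Let $L$ be a linear tangle of order $k+1$ on $(X,f)$ and let $S=\{A\subseteq X : X\setminus A\in L\}$. Then $S$ is a single ultrafilter of order $k+1$ on $(X,f)$.
   Context: A function $f:2^X\to\mathbb{N}$ on a finite set $X$ is symmetric submodular if $f(A)=f(X\setminus A)$ for all $A\subseteq X$ and $f(A)+f(B)\ge f(A\cap B)+f(A\cup B)$ for all $A,B\subseteq X$; the pair $(X,f)$ is called a connectivity system. A subset $A\subseteq X$ is $k$-efficient if $f(A)\le k$. A linear tangle of order $k+1$ on $(X,f)$ is a family $L$ of $k$-efficient subsets of $X$ such that: (L1) $\emptyset\in L$; (L2) for each $k$-efficient $A\subseteq X$, exactly one of $A$ and $X\setminus A$ is in $L$; (L3) if $A,B\in L$, $e\in X$ and $f(\{e\})\le k$, then $A\cup B\cup\{e\}\ne X$. A family $S\subseteq 2^X$ is a single ultrafilter of order $k+1$ on $(X,f)$ if: (S1) for any $A\in S$ and $e\in X$, if $f(\{e\})\le k$ and $f(A\cap(X\setminus\{e\}))\le k$, then $A\cap(X\setminus\{e\})\in S$; (S2) for any $A\in S$ and $A\subset B\subseteq X$, if $f(B)\le k$ then $B\in S$; (F3) $\emptyset\notin S$; (S4) for any $A\subseteq X$ with $f(A)\le k$, either $A\in S$ or $X\setminus A\in S$. -}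

module Defs where

open import Data.Nat using (ℕ; _≤_)
open import Data.Fin using (Fin)
open import Data.Fin.Subset using (Subset; ⊥; ⊤; ⁅_⁆; ∁; _∩_; _∪_; _⊂_)
open import Data.Product using (_×_)
open import Data.Sum using (_⊎_)
open import Data.Empty renaming (⊥ to Empty)
open import Relation.Nullary using (¬_)
open import Relation.Binary.PropositionalEquality using (_≡_; _≢_)

-- The finite ground set X is modelled as Fin n; subsets of X are Subset n.
-- A family of subsets of X is a predicate on Subset n.
Family : ℕ → Set₁
Family n = Subset n → Set

IsSymmetricSubmodular : {n : ℕ} → (Subset n → ℕ) → Set
IsSymmetricSubmodular {n} f =
  (∀ (A : Subset n) → f A ≡ f (∁ A)) ×
  (∀ (A B : Subset n) → f (A ∩ B) Data.Nat.+ f (A ∪ B) ≤ f A Data.Nat.+ f B)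

IsLinearTangle : {n : ℕ} → (Subset n → ℕ) → ℕ → Family n → Set
IsLinearTangle {n} f k L =
  (∀ (A : Subset n) → L A → f A ≤ k) ×
  -- (L1)
  L ⊥ ×
  -- (L2) exactly one of A and X∖A is in L
  (∀ (A : Subset n) → f A ≤ k → (L A ⊎ L (∁ A)) × ¬ (L A × L (∁ A))) ×
  -- (L3)
  (∀ (A B : Subset n) (e : Fin n) → L A → L B → f ⁅ e ⁆ ≤ k →
     (A ∪ B) ∪ ⁅ e ⁆ ≢ ⊤)

IsSingleUltrafilter : {n : ℕ} → (Subset n → ℕ) → ℕ → Family n → Set
IsSingleUltrafilter {n} f k S =
  -- (S1)
  (∀ (A : Subset n) (e : Fin n) → S A → f ⁅ e ⁆ ≤ k →
     f (A ∩ ∁ ⁅ e ⁆) ≤ k → S (A ∩ ∁ ⁅ e ⁆)) ×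
  -- (S2)
  (∀ (A B : Subset n) → S A → A ⊂ B → f B ≤ k → S B) ×
  -- (F3)
  ¬ S ⊥ ×
  -- (S4)
  (∀ (A : Subset n) → f A ≤ k → S A ⊎ S (∁ A))

-- If A ∈ S and B ⊇ A up to a
-- single element e, then B ∈ S: otherwise (L2) puts B in L, and X∖A, B, {e} would
-- cover X, against (L3). Upward closure (S2) and removal of an element (S1) are both
-- instances, while (F3) and (S4) are (L1) and (L2) read through complements.
module Submission where

open import Defs
open import Data.Nat using (ℕ; _≤_)
open import Data.Fin using (Fin)
open import Data.Fin.Subset using (Subset; ⊥; ⊤; ⁅_⁆; ∁; _∩_; _∪_; _∈_; _⊆_; _⊂_)
open import Data.Fin.Subset.Properties
  using (_∈?_; ⊆⊤; ⊆-antisym; ⊆-trans; p⊆p∪q; q⊆p∪q; x∈p∩q⁺; x∉p⇒x∈∁p; ∪-assoc; ∪-∩-booleanAlgebra)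
open import Data.Product using (_,_; proj₁; proj₂)
open import Data.Sum using (_⊎_; inj₁; inj₂)
open import Relation.Nullary using (¬_; yes; no; contradiction)
open import Relation.Binary.PropositionalEquality using (_≡_; trans; subst; sym)
import Algebra.Lattice.Properties.BooleanAlgebra as BooleanAlgebraProperties

∁-involutive : ∀ {n} (p : Subset n) → ∁ (∁ p) ≡ p
∁-involutive {n} = BooleanAlgebraProperties.¬-involutive (∪-∩-booleanAlgebra n)

⊤⊆⇒≡⊤ : ∀ {n} {p : Subset n} → ⊤ ⊆ p → p ≡ ⊤
⊤⊆⇒≡⊤ = ⊆-antisym ⊆⊤

⊆⇒∁∪≡⊤ : ∀ {n} {p q : Subset n} → p ⊆ q → ∁ p ∪ q ≡ ⊤
⊆⇒∁∪≡⊤ {p = p} {q} p⊆q = ⊤⊆⇒≡⊤ covered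
  where
  covered : ∀ {x} → x ∈ ⊤ → x ∈ ∁ p ∪ q
  covered {x} _ with x ∈? p
  ... | yes x∈p = q⊆p∪q (∁ p) q (p⊆q x∈p)
  ... | no  x∉p = p⊆p∪q q (x∉p⇒x∈∁p x∉p)

p⊆p∩∁q∪q : ∀ {n} (p q : Subset n) → p ⊆ (p ∩ ∁ q) ∪ q
p⊆p∩∁q∪q p q {x} x∈p with x ∈? q
... | yes x∈q = q⊆p∪q (p ∩ ∁ q) q x∈q
... | no  x∉q = p⊆p∪q q (x∈p∩q⁺ (x∈p , x∉p⇒x∈∁p x∉q))

private
  variable
    n k : ℕ
    f : Subset n → ℕ
    L : Family n
    A B : Subset n
    e : Fin n

Dual : Family n → Family n
Dual L A = L (∁ A)

dual-⊆-∪⁅⁆ : IsLinearTangle f k L → Dual L A → A ⊆ B ∪ ⁅ e ⁆ →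
             f ⁅ e ⁆ ≤ k → f B ≤ k → Dual L B
dual-⊆-∪⁅⁆ {A = A} {B = B} {e = e} (_ , _ , exactlyOne , noCover) ∁A∈L A⊆B∪e fe≤k fB≤k
  with proj₁ (exactlyOne B fB≤k)
... | inj₂ ∁B∈L = ∁B∈L
... | inj₁ B∈L  = contradiction covers (noCover (∁ A) B e ∁A∈L B∈L fe≤k)
  where
  covers : (∁ A ∪ B) ∪ ⁅ e ⁆ ≡ ⊤
  covers = trans (∪-assoc (∁ A) B ⁅ e ⁆) (⊆⇒∁∪≡⊤ A⊆B∪e)

dual-∩∁⁅⁆ : IsLinearTangle f k L → Dual L A → f ⁅ e ⁆ ≤ k → f (A ∩ ∁ ⁅ e ⁆) ≤ k →
            Dual L (A ∩ ∁ ⁅ e ⁆)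
dual-∩∁⁅⁆ {A = A} {e = e} tangle ∁A∈L = dual-⊆-∪⁅⁆ tangle ∁A∈L (p⊆p∩∁q∪q A ⁅ e ⁆)

dual-⊂ : (∀ e → f ⁅ e ⁆ ≤ k) → IsLinearTangle f k L → Dual L A → A ⊂ B → f B ≤ k → Dual L B
dual-⊂ singletons≤k tangle ∁A∈L (A⊆B , e , _) =
  dual-⊆-∪⁅⁆ tangle ∁A∈L (⊆-trans A⊆B (p⊆p∪q ⁅ e ⁆)) (singletons≤k e)

⊥∉dual : IsLinearTangle f k L → ¬ Dual L ⊥
⊥∉dual (efficient , ∅∈L , exactlyOne , _) ∁∅∈L =
  proj₂ (exactlyOne ⊥ (efficient ⊥ ∅∈L)) (∅∈L , ∁∅∈L)

dual-total : IsLinearTangle f k L → f A ≤ k → Dual L A ⊎ Dual L (∁ A)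
dual-total {L = L} {A = A} (_ , _ , exactlyOne , _) fA≤k with proj₁ (exactlyOne A fA≤k)
... | inj₁ A∈L  = inj₂ (subst L (sym (∁-involutive A)) A∈L)
... | inj₂ ∁A∈L = inj₁ ∁A∈L

lemma17 : (n : ℕ) (f : Subset n → ℕ) (k : ℕ) →
    IsSymmetricSubmodular f →
    (∀ (e : Fin n) → f ⁅ e ⁆ ≤ k) →
    (L : Family n) → IsLinearTangle f k L →
    IsSingleUltrafilter f k (λ A → L (∁ A))
lemma17 n f k _ singletons≤k L tangle =
    (λ A e → dual-∩∁⁅⁆ tangle)
  , (λ A B → dual-⊂ singletons≤k tangle)
  , ⊥∉dual tangle
  , (λ A → dual-total tangle)
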